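{- For every integer $n \ge 2$, $\mathrm{indsat}(n, \{2K_2, P_4, C_4\}) \neq 0$.
   Context: All graphs are finite and simple; $2K_2$ is the disjoint union of two edges, $P_4$ the path on four vertices, $C_4$ the cycle on four vertices. A trigraph $T$ consists of a finite vertex set $V(T)$ together with a partition of the set of unordered pairs of distinct vertices of $V(T)$ into black edges, white edges and gray edges. A realization of $T$ is a graph with vertex set $V(T)$ whose edge set consists of all black edges together with some subset of the gray edges. For a family $\mathcal F$ of graphs, a trigraph $T$ is $\mathcal F$-induced-saturated if no realization of $T$ contains any member of $\mathcal F$ as an induced subgraph, but for every black or white edge $e$ of $T$, the trigraph obtained from $T$ by changing $e$ to gray has a realization containing some member of $\mathcal F$ as an induced subgraph. $\mathrm{indsat}(n,\mathcal F)$ is the minimum number of gray edges in an $\mathcal F$-induced-saturated trigraph on $n$ vertices. -}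

module Defs where

open import Data.Nat using (ℕ)
open import Data.Fin using (Fin; zero; suc)
open import Data.Bool using (Bool; true; false; _∧_; _∨_; if_then_else_)
open import Data.Bool.Properties using (∧-comm; ∨-comm)
open import Relation.Nullary.Decidable using (⌊_⌋)
open import Data.Product using (Σ; _×_; ∃; ∃-syntax)
open import Data.Sum using (_⊎_)
open import Relation.Binary.PropositionalEquality using (_≡_; _≢_; refl; trans; cong₂)
open import Relation.Nullary using (¬_; yes; no)
open import Data.Fin using (_≟_)
open import Function.Definitions using (Injective)

data Colour : Set where
  black white gray : Colour

-- A trigraph on vertex set Fin n: a colour for each pair; only pairs of
-- distinct vertices are meaningful (diagonal values are ignored).
record Trigraph (n : ℕ) : Set where
  field
    col : Fin n → Fin n → Colour
    col-sym : ∀ x y → col x y ≡ col y x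
open Trigraph public

record Graph (n : ℕ) : Set where
  field
    adj : Fin n → Fin n → Bool
    adj-sym : ∀ x y → adj x y ≡ adj y x
    adj-irrefl : ∀ x → adj x x ≡ false
open Graph public

IsRealization : ∀ {n} → Trigraph n → Graph n → Set
IsRealization T G = ∀ x y → x ≢ y →
  (col T x y ≡ black → adj G x y ≡ true) × (col T x y ≡ white → adj G x y ≡ false)

ContainsInduced : ∀ {n k} → Graph n → (Fin k → Fin k → Bool) → Set
ContainsInduced {n} {k} G H =
  Σ (Fin k → Fin n) λ f → Injective _≡_ _≡_ f ×
    (∀ i j → i ≢ j → adj G (f i) (f j) ≡ H i j)

twoK2 : Fin 4 → Fin 4 → Bool
twoK2 zero (suc zero) = true
twoK2 (suc zero) zero = true
twoK2 (suc (suc zero)) (suc (suc (suc zero))) = true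
twoK2 (suc (suc (suc zero))) (suc (suc zero)) = true
twoK2 _ _ = false

P4 : Fin 4 → Fin 4 → Bool
P4 zero (suc zero) = true
P4 (suc zero) zero = true
P4 (suc zero) (suc (suc zero)) = true
P4 (suc (suc zero)) (suc zero) = true
P4 (suc (suc zero)) (suc (suc (suc zero))) = true
P4 (suc (suc (suc zero))) (suc (suc zero)) = true
P4 _ _ = false

C4 : Fin 4 → Fin 4 → Bool
C4 zero (suc zero) = true
C4 (suc zero) zero = true
C4 (suc zero) (suc (suc zero)) = true
C4 (suc (suc zero)) (suc zero) = true
C4 (suc (suc zero)) (suc (suc (suc zero))) = true
C4 (suc (suc (suc zero))) (suc (suc zero)) = true
C4 (suc (suc (suc zero))) zero = true
C4 zero (suc (suc (suc zero))) = true
C4 _ _ = false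

ContainsF : ∀ {n} → Graph n → Set
ContainsF G = ContainsInduced G twoK2 ⊎ ContainsInduced G P4 ⊎ ContainsInduced G C4

HasBadRealization : ∀ {n} → Trigraph n → Set
HasBadRealization {n} T = Σ (Graph n) λ G → IsRealization T G × ContainsF G

isPair : ∀ {n} → Fin n → Fin n → Fin n → Fin n → Bool
isPair u v x y = (⌊ x ≟ u ⌋ ∧ ⌊ y ≟ v ⌋) ∨ (⌊ x ≟ v ⌋ ∧ ⌊ y ≟ u ⌋)

isPair-sym : ∀ {n} (u v x y : Fin n) → isPair u v x y ≡ isPair u v y x
isPair-sym u v x y =
  trans (∨-comm (⌊ x ≟ u ⌋ ∧ ⌊ y ≟ v ⌋) (⌊ x ≟ v ⌋ ∧ ⌊ y ≟ u ⌋))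
        (cong₂ _∨_ (∧-comm ⌊ x ≟ v ⌋ ⌊ y ≟ u ⌋) (∧-comm ⌊ x ≟ u ⌋ ⌊ y ≟ v ⌋))

makeGray : ∀ {n} → Trigraph n → Fin n → Fin n → Trigraph n
makeGray {n} T u v = record { col = c ; col-sym = c-sym }
  where
  c : Fin n → Fin n → Colour
  c x y = if isPair u v x y then gray else col T x y
  c-sym : ∀ x y → c x y ≡ c y x
  c-sym x y rewrite isPair-sym u v x y | col-sym T x y = refl

IsSaturated : ∀ {n} → Trigraph n → Set
IsSaturated {n} T =
  ¬ HasBadRealization T ×
  (∀ u v → u ≢ v → col T u v ≢ gray → HasBadRealization (makeGray T u v))

-- A trigraph without gray edges has exactly one realization G, so if it is
-- saturated then G is {2K2, P4, C4}-free, i.e. G has no alternating 4-cycle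
-- x ~ p ≁ y ~ q ≁ x.  Equivalently, the vicinal relation  a ≼ b : N(a) ⊆ N[b]
-- is a total preorder.  Take v greatest and w least for it.  Toggling the
-- pair vw of G creates no alternating 4-cycle: one through the pair vw would
-- contradict the maximality of v (if vw is an edge of the cycle) or the
-- minimality of w (if it is a non-edge).  So making vw gray does not produce a
-- bad realization, and T is not saturated.
module Submission where

open import Defs
open import Level using (Level)
open import Data.Nat using (ℕ; suc; _≤_; s≤s)
open import Data.Fin using (Fin; suc; punchIn; punchOut; _≟_)
open import Data.Fin.Patterns using (0F; 1F; 2F; 3F)
open import Data.Fin.Properties using (all?; any?; punchInᵢ≢i; punchIn-punchOut)
open import Data.Bool using (Bool; true; false)
import Data.Bool.Properties as Bool
open import Data.Product using (Σ; ∃-syntax; _×_; _,_; proj₁; proj₂)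
open import Data.Sum using (_⊎_; inj₁; inj₂; reduce)
open import Data.Empty using (⊥)
open import Function using (_∘_; flip)
open import Function.Definitions using (Injective)
open import Relation.Binary.Core using (Rel)
open import Relation.Binary.Definitions using (Transitive; Total)
open import Relation.Nullary using (¬_; Dec; yes; no; contradiction)
open import Relation.Nullary.Decidable using (¬?; _×-dec_; _⊎-dec_; _→-dec_; from-yes)
open import Relation.Binary.PropositionalEquality
  using (_≡_; _≢_; refl; sym; trans; cong; subst)

true≢false : true ≢ false
true≢false ()

module _ {ℓ : Level} where

  greatest : ∀ {k} (R : Rel (Fin (suc k)) ℓ) → Transitive R → Total R →
             ∃[ v ] (∀ a → R a v)
  greatest {0} R _ total = 0F , λ { 0F → reduce (total 0F 0F) }
  greatest {suc k} R R-trans total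
    with greatest (λ i j → R (suc i) (suc j)) R-trans (λ i j → total (suc i) (suc j))
  ... | v , below-v with total 0F (suc v)
  ...   | inj₁ 0≤v = suc v , λ { 0F → 0≤v ; (suc a) → below-v a }
  ...   | inj₂ v≤0 = 0F , λ { 0F → reduce (total 0F 0F) ; (suc a) → R-trans (below-v a) v≤0 }

  least : ∀ {k} (R : Rel (Fin (suc k)) ℓ) → Transitive R → Total R →
          ∃[ w ] (∀ a → R w a)
  least R R-trans total = greatest (flip R) (flip R-trans) (flip total)

  greatest-and-least : ∀ {k} (R : Rel (Fin (suc (suc k))) ℓ) → Transitive R → Total R →
                       ∃[ v ] ∃[ w ] v ≢ w × (∀ a → R a v) × (∀ a → R w a)
  greatest-and-least R R-trans total with greatest R R-trans total
  ... | v , below-v with least (λ i j → R (punchIn v i) (punchIn v j)) R-trans (λ i j → total _ _)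
  ... | j , above-w = v , punchIn v j , punchInᵢ≢i v j ∘ sym , below-v , above
    where
    above : ∀ a → R (punchIn v j) a
    above a with a ≟ v
    ... | yes refl = below-v (punchIn v j)
    ... | no a≢v = subst (R (punchIn v j)) (punchIn-punchOut (a≢v ∘ sym))
                     (above-w (punchOut (a≢v ∘ sym)))

module _ {n : ℕ} (G : Graph n) where

  adjacent⇒≢ : ∀ {a b} → adj G a b ≡ true → a ≢ b
  adjacent⇒≢ {a} e refl = true≢false (trans (sym e) (adj-irrefl G a))

  separated⇒≢ : ∀ {a b c} → adj G a c ≡ true → adj G b c ≡ false → a ≢ b
  separated⇒≢ e f refl = true≢false (trans (sym e) f)

  adj-flip : ∀ {a b β} → adj G a b ≡ β → adj G b a ≡ β
  adj-flip {a} {b} e = trans (adj-sym G b a) e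

record AlternatingC4 {n : ℕ} (G : Graph n) : Set where
  field
    x p y q : Fin n
    p≢y : p ≢ y
    q≢x : q ≢ x
    xp : adj G x p ≡ true
    py : adj G p y ≡ false
    yq : adj G y q ≡ true
    qx : adj G q x ≡ false

  x≢p : x ≢ p
  x≢p = adjacent⇒≢ G xp

  y≢q : y ≢ q
  y≢q = adjacent⇒≢ G yq

  x≢y : x ≢ y
  x≢y = separated⇒≢ G xp (adj-flip G py)

  p≢q : p ≢ q
  p≢q = separated⇒≢ G (adj-flip G xp) qx

module _ {n : ℕ} {G : Graph n} where

  rotate : AlternatingC4 G → AlternatingC4 G
  rotate c = record
    { x = y ; p = q ; y = x ; q = p ; p≢y = q≢x ; q≢x = p≢y
    ; xp = yq ; py = qx ; yq = xp ; qx = py }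
    where open AlternatingC4 c

  reflect : AlternatingC4 G → AlternatingC4 G
  reflect c = record
    { x = p ; p = x ; y = q ; q = y ; p≢y = q≢x ∘ sym ; q≢x = p≢y ∘ sym
    ; xp = adj-flip G xp ; py = adj-flip G qx ; yq = adj-flip G yq ; qx = adj-flip G py }
    where open AlternatingC4 c

on-distinct-pairs : ∀ {ℓ} (P : Fin 4 → Fin 4 → Set ℓ) → (∀ {i j} → P i j → P j i) →
                    P 0F 1F → P 0F 2F → P 0F 3F → P 1F 2F → P 1F 3F → P 2F 3F →
                    ∀ i j → i ≢ j → P i j
on-distinct-pairs P P-sym p01 p02 p03 p12 p13 p23 = go
  where
  go : ∀ i j → i ≢ j → P i j
  go 0F 1F _ = p01
  go 0F 2F _ = p02
  go 0F 3F _ = p03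
  go 1F 2F _ = p12
  go 1F 3F _ = p13
  go 2F 3F _ = p23
  go 1F 0F _ = P-sym p01
  go 2F 0F _ = P-sym p02
  go 3F 0F _ = P-sym p03
  go 2F 1F _ = P-sym p12
  go 3F 1F _ = P-sym p13
  go 3F 2F _ = P-sym p23
  go 0F 0F i≢i = contradiction refl i≢i
  go 1F 1F i≢i = contradiction refl i≢i
  go 2F 2F i≢i = contradiction refl i≢i
  go 3F 3F i≢i = contradiction refl i≢i

symmetric? : ∀ {k} (H : Fin k → Fin k → Bool) → Dec (∀ i j → H i j ≡ H j i)
symmetric? H = all? λ i → all? λ j → H i j Bool.≟ H j i

module _ {n : ℕ} (G : Graph n) where

  containsInduced₄ : (H : Fin 4 → Fin 4 → Bool) → (∀ i j → H i j ≡ H j i) →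
                     (a b c d : Fin n) →
             a ≢ b → a ≢ c → a ≢ d → b ≢ c → b ≢ d → c ≢ d →
             adj G a b ≡ H 0F 1F → adj G a c ≡ H 0F 2F → adj G a d ≡ H 0F 3F →
             adj G b c ≡ H 1F 2F → adj G b d ≡ H 1F 3F → adj G c d ≡ H 2F 3F →
             ContainsInduced G H
  containsInduced₄ H H-sym a b c d ab ac ad bc bd cd eab eac ead ebc ebd ecd = f , f-injective , f-induces
    where
    f : Fin 4 → Fin n
    f 0F = a
    f 1F = b
    f 2F = c
    f 3F = d
    f-distinct : ∀ i j → i ≢ j → f i ≢ f j
    f-distinct = on-distinct-pairs (λ i j → f i ≢ f j) (_∘ sym) ab ac ad bc bd cd
    f-injective : Injective _≡_ _≡_ f
    f-injective {i} {j} e with i ≟ j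
    ... | yes i≡j = i≡j
    ... | no i≢j = contradiction e (f-distinct i j i≢j)
    f-induces : ∀ i j → i ≢ j → adj G (f i) (f j) ≡ H i j
    f-induces = on-distinct-pairs (λ i j → adj G (f i) (f j) ≡ H i j)
                  (λ {i} {j} e → trans (adj-flip G e) (H-sym i j)) eab eac ead ebc ebd ecd

  alternatingC4⇒containsF : AlternatingC4 G → ContainsF G
  alternatingC4⇒containsF c = by-diagonals (adj G x y) (adj G p q) refl refl
    where
    open AlternatingC4 c
    by-diagonals : ∀ β γ → adj G x y ≡ β → adj G p q ≡ γ → ContainsF G
    by-diagonals false false xy pq = inj₁ (containsInduced₄ twoK2 (from-yes (symmetric? twoK2)) x p y q
      x≢p x≢y (q≢x ∘ sym) p≢y p≢q y≢q xp xy (adj-flip G qx) py pq yq)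
    by-diagonals true false xy pq = inj₂ (inj₁ (containsInduced₄ P4 (from-yes (symmetric? P4)) p x y q
      (x≢p ∘ sym) p≢y p≢q x≢y (q≢x ∘ sym) y≢q (adj-flip G xp) py pq xy (adj-flip G qx) yq))
    by-diagonals false true xy pq = inj₂ (inj₁ (containsInduced₄ P4 (from-yes (symmetric? P4)) x p q y
      x≢p (q≢x ∘ sym) x≢y p≢q p≢y (y≢q ∘ sym) xp (adj-flip G qx) xy pq py (adj-flip G yq)))
    by-diagonals true true xy pq = inj₂ (inj₂ (containsInduced₄ C4 (from-yes (symmetric? C4)) x p q y
      x≢p (q≢x ∘ sym) x≢y p≢q p≢y (y≢q ∘ sym) xp (adj-flip G qx) xy pq py (adj-flip G yq)))

  containsF⇒alternatingC4 : ContainsF G → AlternatingC4 G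
  containsF⇒alternatingC4 (inj₁ (f , f-inj , h)) = record
    { x = f 0F ; p = f 1F ; y = f 2F ; q = f 3F ; p≢y = (λ ()) ∘ f-inj ; q≢x = (λ ()) ∘ f-inj
    ; xp = h 0F 1F (λ ()) ; py = h 1F 2F (λ ()) ; yq = h 2F 3F (λ ()) ; qx = h 3F 0F (λ ()) }
  containsF⇒alternatingC4 (inj₂ (inj₁ (f , f-inj , h))) = record
    { x = f 1F ; p = f 0F ; y = f 2F ; q = f 3F ; p≢y = (λ ()) ∘ f-inj ; q≢x = (λ ()) ∘ f-inj
    ; xp = h 1F 0F (λ ()) ; py = h 0F 2F (λ ()) ; yq = h 2F 3F (λ ()) ; qx = h 3F 1F (λ ()) }
  containsF⇒alternatingC4 (inj₂ (inj₂ (f , f-inj , h))) = record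
    { x = f 0F ; p = f 3F ; y = f 1F ; q = f 2F ; p≢y = (λ ()) ∘ f-inj ; q≢x = (λ ()) ∘ f-inj
    ; xp = h 0F 3F (λ ()) ; py = h 3F 1F (λ ()) ; yq = h 1F 2F (λ ()) ; qx = h 2F 0F (λ ()) }

_≼[_]_ : ∀ {n} → Fin n → Graph n → Fin n → Set
a ≼[ G ] b = ∀ z → z ≢ b → adj G a z ≡ true → adj G b z ≡ true

module _ {n : ℕ} (G : Graph n) where

  ≼-trans : Transitive (_≼[ G ]_)
  ≼-trans {a} {b} {c} a≼b b≼c z z≢c az with z ≟ b
  ... | no z≢b = b≼c z z≢c (a≼b z z≢b az)
  ... | yes refl with a ≟ c
  ...   | yes refl = az
  ...   | no a≢c = adj-flip G (a≼b c (z≢c ∘ sym) (adj-flip G (b≼c a a≢c (adj-flip G az))))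

  _≼?_ : ∀ a b → Dec (a ≼[ G ] b)
  a ≼? b = all? λ z → ¬? (z ≟ b) →-dec (adj G a z Bool.≟ true →-dec adj G b z Bool.≟ true)

  module _ (no-alternatingC4 : ¬ AlternatingC4 G) where

    separated⇒≼ : ∀ {a b p} → p ≢ b → adj G a p ≡ true → adj G b p ≡ false → b ≼[ G ] a
    separated⇒≼ {a} {b} {p} p≢b ap bp z z≢a bz with adj G a z in az
    ... | true = refl
    ... | false = contradiction
      (record { x = a ; p = p ; y = b ; q = z ; p≢y = p≢b ; q≢x = z≢a
              ; xp = ap ; py = adj-flip G bp ; yq = bz ; qx = adj-flip G az })
      no-alternatingC4

    ≼-total : Total (_≼[ G ]_)
    ≼-total a b with b ≼? a
    ... | yes b≼a = inj₂ b≼a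
    ... | no b⋠a = inj₁ a≼b
      where
      a≼b : a ≼[ G ] b
      a≼b z z≢b az with adj G b z in bz
      ... | true = refl
      ... | false = contradiction (separated⇒≼ z≢b az bz) b⋠a

SamePair : ∀ {n} → Fin n → Fin n → Fin n → Fin n → Set
SamePair v w a b = (a ≡ v × b ≡ w) ⊎ (a ≡ w × b ≡ v)

module Toggle {n : ℕ} (G G' : Graph n) (v w : Fin n)
  (agree : ∀ a b → SamePair v w a b ⊎ adj G' a b ≡ adj G a b)
  (below-v : ∀ a → a ≼[ G ] v) (above-w : ∀ a → w ≼[ G ] a) where

  Agrees : Fin n → Fin n → Set
  Agrees a b = SamePair v w a b ⊎ adj G' a b ≡ adj G a b

  agree-outside : ∀ {a b} → a ≢ v → a ≢ w → adj G' a b ≡ adj G a b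
  agree-outside {a} {b} a≢v a≢w with agree a b
  ... | inj₁ (inj₁ (a≡v , _)) = contradiction a≡v a≢v
  ... | inj₁ (inj₂ (a≡w , _)) = contradiction a≡w a≢w
  ... | inj₂ e = e

  to-G : ∀ {a b β} → a ≢ v → a ≢ w → adj G' a b ≡ β → adj G a b ≡ β
  to-G a≢v a≢w e = trans (sym (agree-outside a≢v a≢w)) e

  -- y ~ q forces v ~ q, which is the non-edge q x.
  vw-edge : (c : AlternatingC4 G') → AlternatingC4.x c ≡ v → AlternatingC4.p c ≡ w → ⊥
  vw-edge c x≡v p≡w =
    true≢false (trans (sym vq) (adj-flip G (subst (λ t → adj G q t ≡ false) x≡v qx-G)))
    where
    open AlternatingC4 c
    qx-G : adj G q x ≡ false
    qx-G = to-G (λ e → q≢x (trans e (sym x≡v))) (λ e → p≢q (trans p≡w (sym e))) qx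
    vq : adj G v q ≡ true
    vq = below-v y q (λ e → q≢x (trans e (sym x≡v)))
           (to-G (λ e → x≢y (trans x≡v (sym e))) (λ e → p≢y (trans p≡w (sym e))) yq)

  -- w ~ x forces q ~ x, which is a non-edge.
  vw-non-edge : (c : AlternatingC4 G') → AlternatingC4.p c ≡ w → AlternatingC4.y c ≡ v → ⊥
  vw-non-edge c p≡w y≡v = true≢false (trans (sym qx-via-w) qx-G)
    where
    open AlternatingC4 c
    qx-G : adj G q x ≡ false
    qx-G = to-G (λ e → y≢q (trans y≡v (sym e))) (λ e → p≢q (trans p≡w (sym e))) qx
    wx : adj G w x ≡ true
    wx = adj-flip G (subst (λ t → adj G x t ≡ true) p≡w
           (to-G (λ e → x≢y (trans e (sym y≡v))) (λ e → x≢p (trans e (sym p≡w))) xp))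
    qx-via-w : adj G q x ≡ true
    qx-via-w = above-w q x (q≢x ∘ sym) wx

  edge-on-pair : (c : AlternatingC4 G') →
                 SamePair v w (AlternatingC4.x c) (AlternatingC4.p c) → ⊥
  edge-on-pair c (inj₁ (x≡v , p≡w)) = vw-edge c x≡v p≡w
  edge-on-pair c (inj₂ (x≡w , p≡v)) = vw-edge (reflect c) p≡v x≡w

  non-edge-on-pair : (c : AlternatingC4 G') →
                     SamePair v w (AlternatingC4.p c) (AlternatingC4.y c) → ⊥
  non-edge-on-pair c (inj₁ (p≡v , y≡w)) = vw-non-edge (rotate (reflect c)) y≡w p≡v
  non-edge-on-pair c (inj₂ (p≡w , y≡v)) = vw-non-edge c p≡w y≡v

  no-alternatingC4 : ¬ AlternatingC4 G → ¬ AlternatingC4 G'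
  no-alternatingC4 no-alt c = by-sides (agree x p) (agree y q) (agree p y) (agree q x)
    where
    open AlternatingC4 c
    by-sides : Agrees x p → Agrees y q → Agrees p y → Agrees q x → ⊥
    by-sides (inj₁ pair) _ _ _ = edge-on-pair c pair
    by-sides _ (inj₁ pair) _ _ = edge-on-pair (rotate c) pair
    by-sides _ _ (inj₁ pair) _ = non-edge-on-pair c pair
    by-sides _ _ _ (inj₁ pair) = non-edge-on-pair (rotate c) pair
    by-sides (inj₂ e₁) (inj₂ e₂) (inj₂ e₃) (inj₂ e₄) = no-alt (record
      { x = x ; p = p ; y = y ; q = q ; p≢y = p≢y ; q≢x = q≢x
      ; xp = trans (sym e₁) xp ; py = trans (sym e₃) py
      ; yq = trans (sym e₂) yq ; qx = trans (sym e₄) qx })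

Grayless : ∀ {n} → Trigraph n → Set
Grayless T = ∀ a b → a ≢ b → col T a b ≢ gray

isBlack : Colour → Bool
isBlack black = true
isBlack white = false
isBlack gray = false

realization-adj : ∀ {n} (T : Trigraph n) (H : Graph n) → IsRealization T H → ∀ {a b} → a ≢ b →
                  col T a b ≢ gray → adj H a b ≡ isBlack (col T a b)
realization-adj T H realizes {a} {b} a≢b not-gray with col T a b in c
... | black = proj₁ (realizes a b a≢b) c
... | white = proj₂ (realizes a b a≢b) c
... | gray = contradiction refl not-gray

module _ {n : ℕ} (T : Trigraph n) where

  blackGraph : Graph n
  blackGraph = record { adj = b ; adj-sym = b-sym ; adj-irrefl = b-irrefl }
    where
    b : Fin n → Fin n → Bool
    b x y with x ≟ y
    ... | yes _ = false
    ... | no _ = isBlack (col T x y)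
    b-sym : ∀ x y → b x y ≡ b y x
    b-sym x y with x ≟ y | y ≟ x
    ... | yes _ | yes _ = refl
    ... | yes x≡y | no y≢x = contradiction (sym x≡y) y≢x
    ... | no x≢y | yes y≡x = contradiction (sym y≡x) x≢y
    ... | no _ | no _ rewrite col-sym T x y = refl
    b-irrefl : ∀ x → b x x ≡ false
    b-irrefl x with x ≟ x
    ... | yes _ = refl
    ... | no x≢x = contradiction refl x≢x

  blackGraph-realizes : IsRealization T blackGraph
  blackGraph-realizes x y x≢y with x ≟ y
  ... | yes x≡y = contradiction x≡y x≢y
  ... | no _ = cong isBlack , cong isBlack

  makeGray-col : ∀ {v w a b} → ¬ SamePair v w a b → col (makeGray T v w) a b ≡ col T a b
  makeGray-col {v} {w} {a} {b} ¬pair with a ≟ v | b ≟ w | a ≟ w | b ≟ v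
  ... | yes a≡v | yes b≡w | _ | _ = contradiction (inj₁ (a≡v , b≡w)) ¬pair
  ... | _ | _ | yes a≡w | yes b≡v = contradiction (inj₂ (a≡w , b≡v)) ¬pair
  ... | no _ | _ | no _ | _ = refl
  ... | no _ | _ | yes _ | no _ = refl
  ... | yes _ | no _ | no _ | _ = refl
  ... | yes _ | no _ | yes _ | no _ = refl

  makeGray-realization-adj : Grayless T →
    ∀ v w (G' : Graph n) → IsRealization (makeGray T v w) G' →
    ∀ {a b} → a ≢ b → ¬ SamePair v w a b → adj G' a b ≡ isBlack (col T a b)
  makeGray-realization-adj grayless v w G' realizes {a} {b} a≢b ¬pair =
    subst (λ c → adj G' a b ≡ isBlack c) col-unchanged
      (realization-adj (makeGray T v w) G' realizes a≢b
        (grayless a b a≢b ∘ trans (sym col-unchanged)))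
    where
    col-unchanged : col (makeGray T v w) a b ≡ col T a b
    col-unchanged = makeGray-col ¬pair

  makeGray-realization-agrees : Grayless T →
    ∀ v w (G' : Graph n) → IsRealization (makeGray T v w) G' →
    ∀ a b → SamePair v w a b ⊎ adj G' a b ≡ adj blackGraph a b
  makeGray-realization-agrees grayless v w G' realizes a b
    with (a ≟ v ×-dec b ≟ w) ⊎-dec (a ≟ w ×-dec b ≟ v)
  ... | yes pair = inj₁ pair
  ... | no ¬pair = inj₂ (off-pair (a ≟ b))
    where
    off-pair : Dec (a ≡ b) → adj G' a b ≡ adj blackGraph a b
    off-pair (yes refl) = trans (adj-irrefl G' a) (sym (adj-irrefl blackGraph a))
    off-pair (no a≢b) = trans (makeGray-realization-adj grayless v w G' realizes a≢b ¬pair)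
      (sym (realization-adj T blackGraph blackGraph-realizes a≢b (grayless a b a≢b)))

gray? : (c : Colour) → Dec (c ≡ gray)
gray? black = no λ ()
gray? white = no λ ()
gray? gray = yes refl

grayless-not-saturated : ∀ {k} (T : Trigraph (suc (suc k))) → Grayless T → ¬ IsSaturated T
grayless-not-saturated T grayless (no-bad-realization , saturated) =
  toggle (greatest-and-least (_≼[ G ]_) (λ {a b c} → ≼-trans G {a} {b} {c})
                               (≼-total G no-alternatingC4))
  where
  G = blackGraph T
  no-alternatingC4 : ¬ AlternatingC4 G
  no-alternatingC4 c =
    no-bad-realization (G , blackGraph-realizes T , alternatingC4⇒containsF G c)
  toggle : (∃[ v ] ∃[ w ] v ≢ w × (∀ a → a ≼[ G ] v) × (∀ a → w ≼[ G ] a)) → ⊥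
  toggle (v , w , v≢w , below-v , above-w) =
    let G' , G'-realizes , G'-bad = saturated v w v≢w (grayless v w v≢w)
    in Toggle.no-alternatingC4 G G' v w (makeGray-realization-agrees T grayless v w G' G'-realizes)
         below-v above-w no-alternatingC4 (containsF⇒alternatingC4 G' G'-bad)

proposition7p2 : (n : ℕ) → 2 ≤ n → (T : Trigraph n) → IsSaturated T →
    Σ (Fin n) λ u → Σ (Fin n) λ v → u ≢ v × col T u v ≡ gray
proposition7p2 (suc (suc k)) (s≤s (s≤s _)) T saturated
  with any? (λ u → any? λ v → ¬? (u ≟ v) ×-dec gray? (col T u v))
... | yes gray-pair = gray-pair
... | no no-gray-pair =
  contradiction saturated (grayless-not-saturated T λ u v u≢v g → no-gray-pair (u , v , u≢v , g))
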